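{- Let $k$ be a positive integer. Then $k$ is a multiple of $p^s-1$ if and only if $\Gamma(k)=E\bar a$ for some $\bar a\in\mathbb{Z}^s$. In other words, $\mathfrak{J}=(E\mathbb{Z}^s)\cap(\mathbb{N}^s\setminus\{\bar 0\})$.
   Context: Let $p$ be a prime, $s\ge1$. For $N=\sum_jn_jp^j$ (base $p$), $\Gamma(N)=[u_0,\dots,u_{s-1}]^t\in\mathbb{N}^s$ with $u_i=\sum_{j\equiv i\pmod s}n_j$. With $\bar e_0,\dots,\bar e_{s-1}$ the standard basis of $\mathbb{R}^s$ and indices mod $s$, $\bar\varepsilon_i:=p\bar e_{i-1}-\bar e_i$ and $E$ is the $s\times s$ matrix with columns $\bar\varepsilon_0,\dots,\bar\varepsilon_{s-1}$. $\mathfrak{J}:=\{\Gamma(k): k \text{ a positive multiple of } p^s-1\}$. -}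

module Defs where

open import Data.Nat as ℕ using (ℕ; zero; suc; NonZero; _≡ᵇ_)
open import Data.Nat.DivMod using (_/_; _%_)
open import Data.Nat.Properties using (m^n≢0)
open import Data.Fin using (Fin; toℕ)
import Data.Fin as F
open import Data.Bool using (if_then_else_)
open import Data.Integer as ℤ using (ℤ; +_)

sumℕ : ℕ → (ℕ → ℕ) → ℕ
sumℕ zero    f = 0
sumℕ (suc n) f = sumℕ n f ℕ.+ f n

sumFinℤ : ∀ {s} → (Fin s → ℤ) → ℤ
sumFinℤ {zero}  f = + 0
sumFinℤ {suc s} f = f F.zero ℤ.+ sumFinℤ (λ i → f (F.suc i))


-- the j-th base-p digit n_j of N  (p ≥ 2 in use; p = 0 is a junk case)
digit : (p j N : ℕ) → ℕ
digit zero    j N = 0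
digit (suc q) j N = ((_/_ N (suc q ℕ.^ j)) ⦃ m^n≢0 (suc q) j ⦄) % suc q

-- Γ(N)_i = Σ_{j ≡ i mod s} n_j.  Digits n_j with j ≥ N vanish (p ≥ 2 gives p^j > N),
-- so summing over j < N + 1 is the full (finite) sum.
Γ : (p s : ℕ) .⦃ _ : NonZero s ⦄ → ℕ → Fin s → ℕ
Γ p s N i = sumℕ (suc N) (λ j → if (j % s) ≡ᵇ toℕ i then digit p j N else 0)

δ : ℕ → ℕ → ℤ
δ a b = if a ≡ᵇ b then + 1 else + 0

-- E with columns ε_j = p e_{j-1} - e_j (indices mod s):
-- entry (i , j) = p·[i ≡ j - 1 mod s] − [i = j]
E : (p s : ℕ) .⦃ _ : NonZero s ⦄ → Fin s → Fin s → ℤ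
E p s i j = (+ p) ℤ.* δ (toℕ i) ((toℕ j ℕ.+ (s ℕ.∸ 1)) % s) ℤ.- δ (toℕ i) (toℕ j)

_*ᵥ_ : ∀ {s} → (Fin s → Fin s → ℤ) → (Fin s → ℤ) → Fin s → ℤ
(M *ᵥ a) i = sumFinℤ (λ j → M i j ℤ.* a j)

-- Weight u ∈ ℤˢ by w(u) = Σᵢ pⁱ uᵢ.  Since pʲ ≡ p^(j mod s) modulo pˢ − 1, expanding k in
-- base p gives w(Γ(k)) ≡ k, so pˢ − 1 ∣ k iff pˢ − 1 ∣ w(Γ(k)).  The i-th entry of E a is
-- p a₍ᵢ₊₁₎ − aᵢ, so w(E a) telescopes to (pˢ − 1) a₀.  Conversely, if w(u) = m (pˢ − 1),
-- solve p bᵢ₊₁ − bᵢ = uᵢ downwards from bₛ = m: the same telescoping forces b₀ = m, so b is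
-- periodic and u = E b.  Hence E ℤˢ consists exactly of the u with pˢ − 1 ∣ w(u).
module Submission where

open import Defs
open import Data.Nat using (ℕ; NonZero; _^_; _∸_; _<_)
open import Data.Nat.Divisibility using (_∣_)
open import Data.Nat.Primality using (Prime)
open import Data.Fin using (Fin)
open import Data.Integer using (ℤ; +_)
open import Data.Product using (∃)
open import Function.Bundles using (_⇔_)
open import Relation.Binary.PropositionalEquality using (_≡_)

open import Data.Bool using (true; false; if_then_else_)
open import Data.Fin using (toℕ)
import Data.Fin as Fin
open import Data.Fin.Properties using (toℕ-inject₁; toℕ-fromℕ; toℕ-fromℕ<; toℕ<n; toℕ-injective)
open import Data.Integer as ℤ using (_+_; _*_; _-_; -_; 0ℤ; 1ℤ)
import Data.Integer.Divisibility.Signed as ℤ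
open import Data.Integer.Divisibility.Signed
  using (divides; ∣-refl; ∣m∣n⇒∣m+n; ∣m∣n⇒∣m-n; ∣n⇒∣m*n; ∣m⇒∣m*n; ∣ᵤ⇒∣; ∣⇒∣ᵤ)
import Data.Integer.Properties as ℤ
open import Algebra.Properties.Semiring.Sum ℤ.+-*-semiring
  using (sum; sum-syntax; ∑-distrib-+; ∑-comm; *-distribˡ-sum; sum-cong-≗; sum-init-last;
         sum-replicate-zero)
open import Data.Integer.Tactic.RingSolver using (solve-∀)
open import Data.Nat as ℕ using (zero; suc; _≡ᵇ_; z<s; s<s)
open import Data.Nat.DivMod
  using (_/_; _%_; _mod_; m%n<n; m<n⇒m%n≡m; n%n≡0; [m+n]%n≡m%n; m≡m%n+[m/n]*n; n/1≡n;
         m/n/o≡m/[n*o]; /-congʳ; m<n⇒m/n≡0)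
open import Data.Nat.Primality using (prime⇒nonTrivial)
import Data.Nat.Properties as ℕ
import Data.Nat.Tactic.RingSolver as ℕ-Ring
open import Data.Product using (_×_; _,_)
open import Data.Vec.Functional using (Vector; head; tail)
open import Function.Bundles using (mk⇔)
open import Function.Construct.Composition using (_⇔-∘_)
open import Function.Construct.Symmetry using (⇔-sym)
open import Relation.Binary.PropositionalEquality
  using (_≗_; refl; sym; trans; cong; cong₂; subst; module ≡-Reasoning)

sumFinℤ≡sum : ∀ {n} (f : Vector ℤ n) → sumFinℤ f ≡ sum f
sumFinℤ≡sum {zero}  f = refl
sumFinℤ≡sum {suc n} f = cong (_+_ (head f)) (sumFinℤ≡sum (tail f))

∑-toℕ-last : ∀ n (f : ℕ → ℤ) → ∑[ j < suc n ] f (toℕ j) ≡ ∑[ j < n ] f (toℕ j) + f n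
∑-toℕ-last n f = trans (sum-init-last {n} (λ j → f (toℕ j)))
  (cong₂ _+_ (sum-cong-≗ {n} (λ j → cong f (toℕ-inject₁ j))) (cong f (toℕ-fromℕ n)))

sumℕ≡∑ : ∀ n (f : ℕ → ℕ) → + sumℕ n f ≡ ∑[ j < n ] (+ f (toℕ j))
sumℕ≡∑ zero    f = refl
sumℕ≡∑ (suc n) f = trans (ℤ.pos-+ (sumℕ n f) (f n))
  (trans (cong (_+ + f n) (sumℕ≡∑ n f)) (sym (∑-toℕ-last n (λ j → + f j))))

∑-neg : ∀ {n} (f : Vector ℤ n) → ∑[ i < n ] (- f i) ≡ - sum f
∑-neg {zero}  f = refl
∑-neg {suc n} f = trans (cong (_+_ (- head f)) (∑-neg (tail f)))
  (sym (ℤ.neg-distrib-+ (head f) (sum (tail f))))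

∑-distrib-- : ∀ {n} (f g : Vector ℤ n) → ∑[ i < n ] (f i - g i) ≡ sum f - sum g
∑-distrib-- f g = trans (∑-distrib-+ f (λ i → - g i)) (cong (_+_ (sum f)) (∑-neg g))

∑-telescope : ∀ n (g : ℕ → ℤ) → ∑[ i < n ] (g (suc (toℕ i)) - g (toℕ i)) ≡ g n - g 0
∑-telescope zero    g = sym (ℤ.+-inverseʳ (g 0))
∑-telescope (suc n) g = trans (cong (_+_ (g 1 - g 0)) (∑-telescope n (λ j → g (suc j))))
  (collapse (g 0) (g 1) (g (suc n)))
  where
  collapse : ∀ a b c → b - a + (c - b) ≡ c - a
  collapse = solve-∀

∑-δ : ∀ {s} n (c : ℕ → ℤ) → n < s → ∑[ j < s ] (δ n (toℕ j) * c (toℕ j)) ≡ c n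
∑-δ {suc s} zero    c _ = begin
  1ℤ * c 0 + ∑[ j < s ] (δ 0 (suc (toℕ j)) * c (suc (toℕ j)))
    ≡⟨ cong₂ _+_ (ℤ.*-identityˡ (c 0)) (sum-cong-≗ {s} (λ j → ℤ.*-zeroˡ (c (suc (toℕ j))))) ⟩
  c 0 + ∑[ j < s ] 0ℤ
    ≡⟨ cong (_+_ (c 0)) (sum-replicate-zero s) ⟩
  c 0 + 0ℤ
    ≡⟨ ℤ.+-identityʳ (c 0) ⟩
  c 0 ∎
  where open ≡-Reasoning
∑-δ {suc s} (suc n) c (s<s n<s) =
  trans (ℤ.+-identityˡ _) (∑-δ n (λ j → c (suc j)) n<s)

∣-∑ : ∀ {n d} (f : Vector ℤ n) → (∀ i → d ℤ.∣ f i) → d ℤ.∣ sum f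
∣-∑ {zero}  f d∣f = divides 0ℤ refl
∣-∑ {suc n} f d∣f = ∣m∣n⇒∣m+n (d∣f Fin.zero) (∣-∑ (tail f) (λ i → d∣f (Fin.suc i)))

∣m-n⇒∣m⇔∣n : ∀ {d m n} → d ℤ.∣ m - n → d ℤ.∣ m ⇔ d ℤ.∣ n
∣m-n⇒∣m⇔∣n {d} {m} {n} d∣m-n = mk⇔
  (λ d∣m → subst (d ℤ.∣_) (cancel m n) (∣m∣n⇒∣m-n d∣m d∣m-n))
  (λ d∣n → subst (d ℤ.∣_) (restore m n) (∣m∣n⇒∣m+n d∣m-n d∣n))
  where
  cancel : ∀ m n → m - (m - n) ≡ n
  cancel = solve-∀
  restore : ∀ m n → m - n + n ≡ m
  restore = solve-∀

m∸1∣n⇔m-1∣n : ∀ {m} n → 1 ℕ.≤ m → (m ∸ 1) ∣ n ⇔ (+ m - 1ℤ) ℤ.∣ + n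
m∸1∣n⇔m-1∣n {m} n 1≤m = subst (λ d → (m ∸ 1) ∣ n ⇔ d ℤ.∣ + n) (sym m-1≡m∸1) (mk⇔ ∣ᵤ⇒∣ ∣⇒∣ᵤ)
  where
  m-1≡m∸1 : + m - 1ℤ ≡ + (m ∸ 1)
  m-1≡m∸1 = trans (ℤ.m-n≡m⊖n m 1) (ℤ.⊖-≥ 1≤m)

x-1∣x^n-1 : ∀ x n → + x - 1ℤ ℤ.∣ + (x ^ n) - 1ℤ
x-1∣x^n-1 x zero    = divides 0ℤ refl
x-1∣x^n-1 x (suc n) = subst (+ x - 1ℤ ℤ.∣_) (sym split)
  (∣m∣n⇒∣m+n (∣n⇒∣m*n (+ x) (x-1∣x^n-1 x n)) ∣-refl)
  where
  regroup : ∀ x y → x * y - 1ℤ ≡ x * (y - 1ℤ) + (x - 1ℤ)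
  regroup = solve-∀
  split : + (x ℕ.* x ^ n) - 1ℤ ≡ + x * (+ (x ^ n) - 1ℤ) + (+ x - 1ℤ)
  split = trans (cong (_- 1ℤ) (ℤ.pos-* x (x ^ n))) (regroup (+ x) (+ (x ^ n)))

p^j≡p^[j%s]*[p^s]^[j/s] : ∀ p s .⦃ _ : NonZero s ⦄ j →
  p ^ j ≡ p ^ (j % s) ℕ.* (p ^ s) ^ (j / s)
p^j≡p^[j%s]*[p^s]^[j/s] p s j = begin
  p ^ j                                ≡⟨ cong (p ^_) (m≡m%n+[m/n]*n j s) ⟩
  p ^ (j % s ℕ.+ j / s ℕ.* s)          ≡⟨ ℕ.^-distribˡ-+-* p (j % s) (j / s ℕ.* s) ⟩
  p ^ (j % s) ℕ.* p ^ (j / s ℕ.* s)    ≡⟨ cong (λ e → p ^ (j % s) ℕ.* p ^ e) (ℕ.*-comm (j / s) s) ⟩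
  p ^ (j % s) ℕ.* p ^ (s ℕ.* (j / s))  ≡⟨ cong (p ^ (j % s) ℕ.*_) (ℕ.^-*-assoc p s (j / s)) ⟨
  p ^ (j % s) ℕ.* (p ^ s) ^ (j / s)    ∎
  where open ≡-Reasoning

p^s-1∣p^j-p^[j%s] : ∀ p s .⦃ _ : NonZero s ⦄ j →
  + (p ^ s) - 1ℤ ℤ.∣ + (p ^ j) - + (p ^ (j % s))
p^s-1∣p^j-p^[j%s] p s j = subst (+ (p ^ s) - 1ℤ ℤ.∣_) (sym factor)
  (∣n⇒∣m*n (+ r) (x-1∣x^n-1 (p ^ s) (j / s)))
  where
  r : ℕ
  r = p ^ (j % s)
  pull : ∀ a y → a * y - a ≡ a * (y - 1ℤ)
  pull = solve-∀
  factor : + (p ^ j) - + r ≡ + r * (+ ((p ^ s) ^ (j / s)) - 1ℤ)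
  factor = trans (cong (λ z → z - + r)
                       (trans (cong +_ (p^j≡p^[j%s]*[p^s]^[j/s] p s j)) (ℤ.pos-* r ((p ^ s) ^ (j / s)))))
                 (pull (+ r) (+ ((p ^ s) ^ (j / s))))

digit≡ : ∀ p .⦃ _ : NonZero p ⦄ j N → digit p j N ≡ (N / p ^ j) ⦃ ℕ.m^n≢0 p j ⦄ % p
digit≡ (suc q) j N = refl

n<p^n : ∀ {p} → 1 < p → ∀ n → n < p ^ n
n<p^n 1<p zero    = z<s
n<p^n {p@(suc _)} 1<p (suc n) = ℕ.≤-<-trans (n<p^n 1<p n)
  (subst (p ^ n <_) (ℕ.*-comm (p ^ n) p) (ℕ.m<m*n (p ^ n) p ⦃ ℕ.m^n≢0 p n ⦄ 1<p))

base-expansion-prefix : ∀ p .⦃ _ : NonZero p ⦄ N n →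
  N ≡ sumℕ n (λ j → p ^ j ℕ.* digit p j N) ℕ.+ p ^ n ℕ.* (N / p ^ n) ⦃ ℕ.m^n≢0 p n ⦄
base-expansion-prefix p N zero    = sym (trans (ℕ.*-identityˡ _) (n/1≡n N))
base-expansion-prefix p N (suc n) = begin
  N                                              ≡⟨ base-expansion-prefix p N n ⟩
  S ℕ.+ p ^ n ℕ.* Q                              ≡⟨ cong (λ z → S ℕ.+ p ^ n ℕ.* z) (m≡m%n+[m/n]*n Q p) ⟩
  S ℕ.+ p ^ n ℕ.* (Q % p ℕ.+ Q / p ℕ.* p)        ≡⟨ regroup S (p ^ n) (Q % p) (Q / p) p ⟩
  S ℕ.+ p ^ n ℕ.* (Q % p) ℕ.+ p ^ suc n ℕ.* (Q / p)
    ≡⟨ cong₂ (λ d q → S ℕ.+ p ^ n ℕ.* d ℕ.+ p ^ suc n ℕ.* q) (sym (digit≡ p n N)) Q/p≡N/p^[1+n] ⟩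
  S ℕ.+ p ^ n ℕ.* digit p n N ℕ.+ p ^ suc n ℕ.* (N / p ^ suc n) ⦃ ℕ.m^n≢0 p (suc n) ⦄ ∎
  where
  open ≡-Reasoning
  instance
    p^n≢0 : NonZero (p ^ n)
    p^n≢0 = ℕ.m^n≢0 p n
  S Q : ℕ
  S = sumℕ n (λ j → p ^ j ℕ.* digit p j N)
  Q = N / p ^ n
  regroup : ∀ S x d q p → S ℕ.+ x ℕ.* (d ℕ.+ q ℕ.* p) ≡ S ℕ.+ x ℕ.* d ℕ.+ (p ℕ.* x) ℕ.* q
  regroup = ℕ-Ring.solve-∀
  Q/p≡N/p^[1+n] : Q / p ≡ (N / p ^ suc n) ⦃ ℕ.m^n≢0 p (suc n) ⦄
  Q/p≡N/p^[1+n] = trans (m/n/o≡m/[n*o] N (p ^ n) p ⦃ _ ⦄ ⦃ _ ⦄ ⦃ ℕ.m*n≢0 (p ^ n) p ⦄)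
                        (/-congʳ ⦃ ℕ.m*n≢0 (p ^ n) p ⦄ ⦃ ℕ.m^n≢0 p (suc n) ⦄ (ℕ.*-comm (p ^ n) p))

base-expansion : ∀ p → 1 < p → ∀ N → N ≡ sumℕ (suc N) (λ j → p ^ j ℕ.* digit p j N)
base-expansion p@(suc _) 1<p N = begin
  N
    ≡⟨ base-expansion-prefix p N (suc N) ⟩
  S ℕ.+ p ^ suc N ℕ.* (N / p ^ suc N) ⦃ ℕ.m^n≢0 p (suc N) ⦄
    ≡⟨ cong (λ q → S ℕ.+ p ^ suc N ℕ.* q) N/p^[1+N]≡0 ⟩
  S ℕ.+ p ^ suc N ℕ.* 0
    ≡⟨ cong (S ℕ.+_) (ℕ.*-zeroʳ (p ^ suc N)) ⟩
  S ℕ.+ 0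
    ≡⟨ ℕ.+-identityʳ S ⟩
  S ∎
  where
  open ≡-Reasoning
  S : ℕ
  S = sumℕ (suc N) (λ j → p ^ j ℕ.* digit p j N)
  N/p^[1+N]≡0 : (N / p ^ suc N) ⦃ ℕ.m^n≢0 p (suc N) ⦄ ≡ 0
  N/p^[1+N]≡0 = m<n⇒m/n≡0 ⦃ ℕ.m^n≢0 p (suc N) ⦄ (ℕ.<-trans (ℕ.n<1+n N) (n<p^n 1<p (suc N)))

weight : ℕ → ∀ {s} → Vector ℤ s → ℤ
weight p {s} u = ∑[ i < s ] (+ (p ^ toℕ i) * u i)

weight-Γ : ∀ p s .⦃ _ : NonZero s ⦄ k →
  weight p (λ i → + Γ p s k i) ≡ ∑[ j < suc k ] (+ (p ^ (toℕ j % s)) * + digit p (toℕ j) k)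
weight-Γ p s k = begin
  ∑[ i < s ] (+ (p ^ toℕ i) * + sumℕ (suc k) (g (toℕ i)))            ≡⟨ sum-cong-≗ {s} expand ⟩
  ∑[ i < s ] ∑[ j < suc k ] term i j                                  ≡⟨ ∑-comm {s} {suc k} term ⟩
  ∑[ j < suc k ] ∑[ i < s ] term i j                                  ≡⟨ sum-cong-≗ {suc k} select ⟩
  ∑[ j < suc k ] (+ (p ^ (toℕ j % s)) * + d (toℕ j))                 ∎
  where
  open ≡-Reasoning
  d : ℕ → ℕ
  d j = digit p j k
  g : ℕ → ℕ → ℕ
  g n j = if j % s ≡ᵇ n then d j else 0
  term : Fin s → Fin (suc k) → ℤ
  term i j = + (p ^ toℕ i) * + g (toℕ i) (toℕ j)
  indicator : ∀ b x (y : ℕ) → x * + (if b then y else 0) ≡ (if b then 1ℤ else 0ℤ) * (x * + y)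
  indicator true  x y = sym (ℤ.*-identityˡ (x * + y))
  indicator false x y = ℤ.*-zeroʳ x
  expand : ∀ i → + (p ^ toℕ i) * + sumℕ (suc k) (g (toℕ i)) ≡ ∑[ j < suc k ] term i j
  expand i = trans (cong (_*_ (+ (p ^ toℕ i))) (sumℕ≡∑ (suc k) (g (toℕ i))))
                   (*-distribˡ-sum {suc k} (+ (p ^ toℕ i)) (λ j → + g (toℕ i) (toℕ j)))
  select : ∀ j → ∑[ i < s ] term i j ≡ + (p ^ (toℕ j % s)) * + d (toℕ j)
  select j = trans (sum-cong-≗ {s} (λ i → indicator (toℕ j % s ≡ᵇ toℕ i) (+ (p ^ toℕ i)) (d (toℕ j))))
                   (∑-δ (toℕ j % s) (λ n → + (p ^ n) * + d (toℕ j)) (m%n<n (toℕ j) s))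

p^s-1∣k-weight-Γ : ∀ p → 1 < p → ∀ s .⦃ _ : NonZero s ⦄ k →
  + (p ^ s) - 1ℤ ℤ.∣ + k - weight p (λ i → + Γ p s k i)
p^s-1∣k-weight-Γ p 1<p s k = subst (+ (p ^ s) - 1ℤ ℤ.∣_) (sym difference)
  (∣-∑ {suc k} _ (λ j → ∣m⇒∣m*n (+ d (toℕ j)) (p^s-1∣p^j-p^[j%s] p s (toℕ j))))
  where
  open ≡-Reasoning
  d : ℕ → ℕ
  d j = digit p j k
  high low : ℕ → ℤ
  high j = + (p ^ j)
  low  j = + (p ^ (j % s))
  factor : ∀ x y z → x * z - y * z ≡ (x - y) * z
  factor = solve-∀
  expansion : + k ≡ ∑[ j < suc k ] (high (toℕ j) * + d (toℕ j))
  expansion = trans (cong +_ (base-expansion p 1<p k))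
    (trans (sumℕ≡∑ (suc k) (λ j → p ^ j ℕ.* d j))
           (sum-cong-≗ {suc k} (λ j → ℤ.pos-* (p ^ toℕ j) (d (toℕ j)))))
  difference : + k - weight p (λ i → + Γ p s k i)
             ≡ ∑[ j < suc k ] ((high (toℕ j) - low (toℕ j)) * + d (toℕ j))
  difference = begin
    + k - weight p (λ i → + Γ p s k i)
      ≡⟨ cong₂ _-_ expansion (weight-Γ p s k) ⟩
    ∑[ j < suc k ] (high (toℕ j) * + d (toℕ j)) - ∑[ j < suc k ] (low (toℕ j) * + d (toℕ j))
      ≡⟨ ∑-distrib-- {suc k} (λ j → high (toℕ j) * + d (toℕ j)) (λ j → low (toℕ j) * + d (toℕ j)) ⟨
    ∑[ j < suc k ] (high (toℕ j) * + d (toℕ j) - low (toℕ j) * + d (toℕ j))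
      ≡⟨ sum-cong-≗ {suc k} (λ j → factor (high (toℕ j)) (low (toℕ j)) (+ d (toℕ j))) ⟩
    ∑[ j < suc k ] ((high (toℕ j) - low (toℕ j)) * + d (toℕ j)) ∎

*ᵥ-congʳ : ∀ {s} (M : Fin s → Fin s → ℤ) {a b : Vector ℤ s} → a ≗ b → M *ᵥ a ≗ M *ᵥ b
*ᵥ-congʳ M {a} {b} a≗b i = begin
  sumFinℤ (λ j → M i j * a j) ≡⟨ sumFinℤ≡sum (λ j → M i j * a j) ⟩
  ∑[ j < _ ] (M i j * a j)    ≡⟨ sum-cong-≗ (λ j → cong (M i j *_) (a≗b j)) ⟩
  ∑[ j < _ ] (M i j * b j)    ≡⟨ sumFinℤ≡sum (λ j → M i j * b j) ⟨
  sumFinℤ (λ j → M i j * b j) ∎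
  where open ≡-Reasoning

-- (j + t) % (t + 1) is the cyclic predecessor of j < t + 1, so the sum picks out b at the
-- cyclic successor of n; the wrap-around term is where b (t + 1) ≡ b 0 is needed.
∑-δ-cyclic : ∀ t n (b : ℕ → ℤ) → n < suc t → b (suc t) ≡ b 0 →
  ∑[ j < suc t ] (δ n ((toℕ j ℕ.+ t) % suc t) * b (toℕ j)) ≡ b (suc n)
∑-δ-cyclic t n b n<1+t b[1+t]≡b[0] = begin
  δ n (t % suc t) * b 0 + ∑[ j < t ] (δ n ((suc (toℕ j) ℕ.+ t) % suc t) * b (suc (toℕ j)))
    ≡⟨ cong₂ _+_ (cong₂ (λ x y → δ n x * y) t%[1+t]≡t (sym b[1+t]≡b[0]))
                 (sum-cong-≗ {t} (λ j → cong (λ x → δ n x * b (suc (toℕ j)))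
                                             ([1+j+t]%[1+t]≡j (toℕ<n j)))) ⟩
  δ n t * b (suc t) + ∑[ j < t ] (δ n (toℕ j) * b (suc (toℕ j)))
    ≡⟨ ℤ.+-comm (δ n t * b (suc t)) _ ⟩
  ∑[ j < t ] (δ n (toℕ j) * b (suc (toℕ j))) + δ n t * b (suc t)
    ≡⟨ ∑-toℕ-last t (λ j → δ n j * b (suc j)) ⟨
  ∑[ j < suc t ] (δ n (toℕ j) * b (suc (toℕ j)))
    ≡⟨ ∑-δ n (λ j → b (suc j)) n<1+t ⟩
  b (suc n) ∎
  where
  open ≡-Reasoning
  t%[1+t]≡t : t % suc t ≡ t
  t%[1+t]≡t = m<n⇒m%n≡m (ℕ.n<1+n t)
  [1+j+t]%[1+t]≡j : ∀ {j} → j < t → (suc j ℕ.+ t) % suc t ≡ j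
  [1+j+t]%[1+t]≡j {j} j<t = trans (cong (_% suc t) (sym (ℕ.+-suc j t)))
    (trans ([m+n]%n≡m%n j (suc t)) (m<n⇒m%n≡m (ℕ.m<n⇒m<1+n j<t)))

E*ᵥ-periodic : ∀ p s .⦃ _ : NonZero s ⦄ (b : ℕ → ℤ) → b s ≡ b 0 →
  ∀ i → (E p s *ᵥ (λ j → b (toℕ j))) i ≡ + p * b (suc (toℕ i)) - b (toℕ i)
E*ᵥ-periodic p (suc t) b b[s]≡b[0] i = begin
  sumFinℤ (λ j → E p (suc t) i j * b (toℕ j))
    ≡⟨ sumFinℤ≡sum (λ j → E p (suc t) i j * b (toℕ j)) ⟩
  ∑[ j < suc t ] ((+ p * δ n (prev j) - δ n (toℕ j)) * b (toℕ j))
    ≡⟨ sum-cong-≗ {suc t} (λ j → expand (+ p) (δ n (prev j)) (δ n (toℕ j)) (b (toℕ j))) ⟩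
  ∑[ j < suc t ] (+ p * (δ n (prev j) * b (toℕ j)) - δ n (toℕ j) * b (toℕ j))
    ≡⟨ ∑-distrib-- {suc t} (λ j → + p * (δ n (prev j) * b (toℕ j))) (λ j → δ n (toℕ j) * b (toℕ j)) ⟩
  ∑[ j < suc t ] (+ p * (δ n (prev j) * b (toℕ j))) - ∑[ j < suc t ] (δ n (toℕ j) * b (toℕ j))
    ≡⟨ cong₂ _-_ (sym (*-distribˡ-sum {suc t} (+ p) (λ j → δ n (prev j) * b (toℕ j))))
                 (∑-δ n b (toℕ<n i)) ⟩
  + p * ∑[ j < suc t ] (δ n (prev j) * b (toℕ j)) - b n
    ≡⟨ cong (λ x → + p * x - b n) (∑-δ-cyclic t n b (toℕ<n i) b[s]≡b[0]) ⟩
  + p * b (suc n) - b n ∎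
  where
  open ≡-Reasoning
  n : ℕ
  n = toℕ i
  prev : Fin (suc t) → ℕ
  prev j = (toℕ j ℕ.+ t) % suc t
  expand : ∀ c x y z → (c * x - y) * z ≡ c * (x * z) - y * z
  expand = solve-∀

weight-telescope : ∀ p {s} (b : ℕ → ℤ) →
  weight p {s} (λ i → + p * b (suc (toℕ i)) - b (toℕ i)) ≡ + (p ^ s) * b s - b 0
weight-telescope p {s} b = begin
  ∑[ i < s ] (+ (p ^ toℕ i) * (+ p * b (suc (toℕ i)) - b (toℕ i)))
    ≡⟨ sum-cong-≗ {s} (λ i → shift-power (toℕ i)) ⟩
  ∑[ i < s ] (g (suc (toℕ i)) - g (toℕ i))
    ≡⟨ ∑-telescope s g ⟩
  g s - g 0
    ≡⟨ cong (_-_ (g s)) (ℤ.*-identityˡ (b 0)) ⟩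
  + (p ^ s) * b s - b 0 ∎
  where
  open ≡-Reasoning
  g : ℕ → ℤ
  g n = + (p ^ n) * b n
  distribute : ∀ x c y z → x * (c * y - z) ≡ c * x * y - x * z
  distribute = solve-∀
  shift-power : ∀ n → + (p ^ n) * (+ p * b (suc n) - b n) ≡ g (suc n) - g n
  shift-power n = trans (distribute (+ (p ^ n)) (+ p) (b (suc n)) (b n))
    (cong (λ x → x * b (suc n) - g n) (sym (ℤ.pos-* p (p ^ n))))

recurrence-solvable : ∀ c {s} (u : Vector ℤ s) m →
  ∃ λ (b : ℕ → ℤ) → b s ≡ m × ∀ i → u i ≡ c * b (suc (toℕ i)) - b (toℕ i)
recurrence-solvable c {zero}  u m = (λ _ → m) , refl , λ ()
recurrence-solvable c {suc s} u m with recurrence-solvable c (tail u) m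
... | b , b[s]≡m , solves = b′ , b[s]≡m , solves′
  where
  b′ : ℕ → ℤ
  b′ zero    = c * b 0 - head u
  b′ (suc n) = b n
  cancel : ∀ x y → y ≡ x - (x - y)
  cancel = solve-∀
  solves′ : ∀ i → u i ≡ c * b′ (suc (toℕ i)) - b′ (toℕ i)
  solves′ Fin.zero    = cancel (c * b 0) (head u)
  solves′ (Fin.suc i) = solves i

E-image : ∀ p s .⦃ _ : NonZero s ⦄ (u : Vector ℤ s) →
  (∃ λ a → ∀ i → u i ≡ (E p s *ᵥ a) i) ⇔ (+ (p ^ s) - 1ℤ ℤ.∣ weight p u)
E-image p s u = mk⇔ to from
  where
  open ≡-Reasoning
  to : (∃ λ a → ∀ i → u i ≡ (E p s *ᵥ a) i) → + (p ^ s) - 1ℤ ℤ.∣ weight p u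
  to (a , u≡Ea) = divides (A 0) (begin
    weight p u
      ≡⟨ sum-cong-≗ {s} (λ i → cong (_*_ (+ (p ^ toℕ i))) (u≡EA i)) ⟩
    weight p {s} (λ i → + p * A (suc (toℕ i)) - A (toℕ i))
      ≡⟨ weight-telescope p {s} A ⟩
    + (p ^ s) * A s - A 0
      ≡⟨ cong (λ x → + (p ^ s) * x - A 0) A[s]≡A[0] ⟩
    + (p ^ s) * A 0 - A 0
      ≡⟨ factor (+ (p ^ s)) (A 0) ⟩
    A 0 * (+ (p ^ s) - 1ℤ) ∎)
    where
    A : ℕ → ℤ
    A n = a (n mod s)
    a≗A : ∀ i → a i ≡ A (toℕ i)
    a≗A i = cong a (toℕ-injective (sym (trans (toℕ-fromℕ< _) (m<n⇒m%n≡m (toℕ<n i)))))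
    A[s]≡A[0] : A s ≡ A 0
    A[s]≡A[0] = cong a (toℕ-injective (trans (toℕ-fromℕ< _)
      (trans (n%n≡0 s) (sym (trans (toℕ-fromℕ< _) (m<n⇒m%n≡m (ℕ.>-nonZero⁻¹ s)))))))
    u≡EA : ∀ i → u i ≡ + p * A (suc (toℕ i)) - A (toℕ i)
    u≡EA i = trans (u≡Ea i) (trans (*ᵥ-congʳ (E p s) a≗A i) (E*ᵥ-periodic p s A A[s]≡A[0] i))
    factor : ∀ x y → x * y - y ≡ y * (x - 1ℤ)
    factor = solve-∀
  from : + (p ^ s) - 1ℤ ℤ.∣ weight p u → ∃ λ a → ∀ i → u i ≡ (E p s *ᵥ a) i
  from (divides m weight≡) with recurrence-solvable (+ p) {s} u m
  ... | b , b[s]≡m , solves = (λ j → b (toℕ j)) , solved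
    where
    b[0]≡m : b 0 ≡ m
    b[0]≡m = begin
      b 0                                      ≡⟨ isolate (+ (p ^ s)) m (b 0) ⟩
      + (p ^ s) * m - (+ (p ^ s) * m - b 0)    ≡⟨ cong (_-_ (+ (p ^ s) * m)) telescoped ⟩
      + (p ^ s) * m - m * (+ (p ^ s) - 1ℤ)     ≡⟨ collapse (+ (p ^ s)) m ⟩
      m                                        ∎
      where
      isolate : ∀ x y z → z ≡ x * y - (x * y - z)
      isolate = solve-∀
      collapse : ∀ x y → x * y - y * (x - 1ℤ) ≡ y
      collapse = solve-∀
      telescoped : + (p ^ s) * m - b 0 ≡ m * (+ (p ^ s) - 1ℤ)
      telescoped = begin
        + (p ^ s) * m - b 0
          ≡⟨ cong (λ x → + (p ^ s) * x - b 0) b[s]≡m ⟨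
        + (p ^ s) * b s - b 0
          ≡⟨ weight-telescope p {s} b ⟨
        weight p {s} (λ i → + p * b (suc (toℕ i)) - b (toℕ i))
          ≡⟨ sum-cong-≗ {s} (λ i → cong (_*_ (+ (p ^ toℕ i))) (solves i)) ⟨
        weight p u
          ≡⟨ weight≡ ⟩
        m * (+ (p ^ s) - 1ℤ) ∎
    solved : ∀ i → u i ≡ (E p s *ᵥ (λ j → b (toℕ j))) i
    solved i = trans (solves i) (sym (E*ᵥ-periodic p s b (trans b[s]≡m (sym b[0]≡m)) i))

lemma3p4 : (p : ℕ) → Prime p → (s : ℕ) .⦃ _ : NonZero s ⦄ → (k : ℕ) → 0 < k →
    ((p ^ s ∸ 1) ∣ k) ⇔ ∃ (λ (a : Fin s → ℤ) → ∀ i → + (Γ p s k i) ≡ (E p s *ᵥ a) i)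
lemma3p4 p p-prime s k _ =
  ⇔-sym (E-image p s (λ i → + Γ p s k i))
    ⇔-∘ (∣m-n⇒∣m⇔∣n (p^s-1∣k-weight-Γ p 1<p s k)
    ⇔-∘ m∸1∣n⇔m-1∣n k (ℕ.m^n>0 p ⦃ ℕ.>-nonZero (ℕ.<-trans z<s 1<p) ⦄ s))
  where
  1<p : 1 < p
  1<p = ℕ.nonTrivial⇒n>1 p ⦃ prime⇒nonTrivial p-prime ⦄
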